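{- If $G$ is a series-parallel graph, then $\pi^\circ(G) \le 2$.
   Context: A graph is series-parallel if it can be turned into $K_2$ by a sequence of the following operations: (parallel operation) replacing a pair of parallel edges by a single edge joining their common endpoints; (series operation) replacing the pair of edges incident to a vertex of degree $2$, other than two distinguished vertices called source and sink, by a single edge joining the two other endpoints. A pair of non-adjacent edges is separated by a circular ordering of $V(G)$ if the endpoints of the two edges do not alternate in that circular ordering. The circular separation dimension $\pi^\circ(G)$ is the minimum number of circular orderings of $V(G)$ such that every pair of non-adjacent edges of $G$ is separated in at least one of them. -}

module Defs where

open import Data.Nat using (ℕ; _≤_)
open import Data.Fin using (Fin; _<_; toℕ)
open import Data.Fin.Subset using (Subset; ⁅_⁆; _∪_; _∈_; _-_; ⊤)
open import Data.Fin.Permutation using (Permutation′; _⟨$⟩ʳ_)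
open import Data.List using (List; []; _∷_; length)
open import Data.List.Membership.Propositional renaming (_∈_ to _∈ₗ_)
open import Data.List.Relation.Unary.All using (All)
open import Data.List.Relation.Unary.Any using (Any)
open import Data.List.Relation.Unary.AllPairs using (AllPairs)
open import Data.List.Relation.Binary.Permutation.Propositional using (_↭_)
open import Data.Product using (Σ; ∃; ∃-syntax; _×_; _,_; proj₁; proj₂)
open import Data.Sum using (_⊎_)
open import Relation.Nullary using (¬_)
open import Relation.Binary.PropositionalEquality using (_≡_; _≢_)
open import Relation.Binary.Construct.Closure.ReflexiveTransitive using (Star)

-- Edges are (ordered) pairs of vertices, read as unordered pairs.

Edge : ℕ → Set
Edge n = Fin n × Fin n

Joins : ∀ {n} → Edge n → Fin n → Fin n → Set
Joins e x y = (e ≡ (x , y)) ⊎ (e ≡ (y , x))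

Incident : ∀ {n} → Fin n → Edge n → Set
Incident x e = (proj₁ e ≡ x) ⊎ (proj₂ e ≡ x)

record Graph : Set where
  field
    n         : ℕ
    edges     : List (Edge n)
    canonical : All (λ e → proj₁ e < proj₂ e) edges
    distinct  : AllPairs _≢_ edges
open Graph public

-- Series-parallel reductions on multigraphs with terminals s and t.
-- A multigraph state: set of remaining vertices and a multiset (list)
-- of edges, all over the ambient vertex type Fin n.

MState : ℕ → Set
MState n = Subset n × List (Edge n)

data SPStep {n : ℕ} (s t : Fin n) : MState n → MState n → Set where
  parallel : ∀ {V E E′ e₁ e₂ x y} →
             E ↭ (e₁ ∷ e₂ ∷ E′) → Joins e₁ x y → Joins e₂ x y →
             SPStep s t (V , E) (V , e₁ ∷ E′)
  -- replace the two edges at a degree-2 vertex v ∉ {s,t} by one edge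
  series   : ∀ {V E E′ e₁ e₂ u v w} →
             v ∈ V → v ≢ s → v ≢ t → u ≢ v → w ≢ v →
             E ↭ (e₁ ∷ e₂ ∷ E′) → Joins e₁ u v → Joins e₂ v w →
             All (λ e → ¬ Incident v e) E′ →
             SPStep s t (V , E) (V - v , (u , w) ∷ E′)

IsK₂ : ∀ {n} → Fin n → Fin n → MState n → Set
IsK₂ s t (V , E) = s ≢ t × V ≡ (⁅ s ⁆ ∪ ⁅ t ⁆) × Σ (Edge _) (λ e → E ≡ e ∷ [] × Joins e s t)

SeriesParallel : Graph → Set
SeriesParallel G =
  ∃[ s ] ∃[ t ] ∃[ S ] (Star (SPStep {n G} s t) (⊤ , edges G) S × IsK₂ s t S)

-- Circular orderings and separation.
-- A circular ordering of Fin n is given by a bijection σ assigning each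
-- vertex a position (read cyclically).

CircOrd : ℕ → Set
CircOrd n = Permutation′ n

Between : ∀ {n} → Fin n → Fin n → Fin n → Set
Between p a b = (a < p × p < b) ⊎ (b < p × p < a)

Alternate : ∀ {n} → CircOrd n → Edge n → Edge n → Set
Alternate σ (a , b) (c , d) =
  (Between (σ ⟨$⟩ʳ c) (σ ⟨$⟩ʳ a) (σ ⟨$⟩ʳ b) × ¬ Between (σ ⟨$⟩ʳ d) (σ ⟨$⟩ʳ a) (σ ⟨$⟩ʳ b))
  ⊎ (¬ Between (σ ⟨$⟩ʳ c) (σ ⟨$⟩ʳ a) (σ ⟨$⟩ʳ b) × Between (σ ⟨$⟩ʳ d) (σ ⟨$⟩ʳ a) (σ ⟨$⟩ʳ b))

Separates : ∀ {n} → CircOrd n → Edge n → Edge n → Set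
Separates σ e f = ¬ Alternate σ e f

NonAdjacent : ∀ {n} → Edge n → Edge n → Set
NonAdjacent (a , b) (c , d) = a ≢ c × a ≢ d × b ≢ c × b ≢ d

CircSepFamily : (G : Graph) → List (CircOrd (n G)) → Set
CircSepFamily G L =
  ∀ {e f} → e ∈ₗ edges G → f ∈ₗ edges G → NonAdjacent e f →
  Any (λ σ → Separates σ e f) L

CircSepDim≤ : Graph → ℕ → Set
CircSepDim≤ G k = ∃[ L ] (length L ≤ k × CircSepFamily G L)

-- Follow the reduction backwards, keeping two orderings that separate every pair of non-adjacent edges of the
-- current multigraph; for K₂ there is no such pair. Undoing a parallel operation only duplicates an edge. Undoing
-- a series operation subdivides uw by a new vertex v: insert v right after u in the first ordering and right
-- after w in the second. Then uv, resp. vw, joins consecutive positions, so no vertex lies strictly between its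
-- endpoints and it is separated from every edge, while the old edges keep their relative order and stay separated.
module Submission where

open import Defs hiding (n)
open import Data.Nat using (ℕ; suc; z≤n; s≤s)
import Data.Nat as ℕ
import Data.Nat.Properties as ℕₚ
open import Data.Fin as Fin using (Fin; toℕ; punchIn; punchOut)
open import Data.Fin.Properties
  using (<-trans; <⇒≢; ≤∧≢⇒<; punchIn-injective; punchIn-mono-≤; punchIn-cancel-≤; punchIn-punchOut)
open import Data.Fin.Permutation using (_⟨$⟩ʳ_; _≈_; remove; insert; insert-punchIn; remove-insert; punchIn-permute; id)
open import Data.List using (List; []; _∷_)
open import Data.List.Membership.Propositional renaming (_∈_ to _∈ₗ_)
open import Data.List.Relation.Unary.Any using (here; there)
open import Data.List.Relation.Unary.All using (All; lookup)
open import Data.List.Relation.Binary.Permutation.Propositional using (_↭_)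
open import Data.List.Relation.Binary.Permutation.Propositional.Properties using (∈-resp-↭)
open import Data.Product using (∃; ∃₂; _×_; _,_; proj₁; proj₂)
open import Data.Sum using (_⊎_; inj₁; inj₂)
import Data.Sum as Sum
import Data.Product as Product
open import Function using (_∘_)
open import Function.Bundles using (Injection)
open import Function.Properties.Inverse using (↔⇒↣)
open import Relation.Nullary using (¬_; yes; no; contradiction)
open import Relation.Binary.PropositionalEquality
open import Relation.Binary.Construct.Closure.ReflexiveTransitive using (Star; ε; _◅_)

private
  variable
    m n : ℕ

permute-injective : (σ : CircOrd n) {x y : Fin n} → σ ⟨$⟩ʳ x ≡ σ ⟨$⟩ʳ y → x ≡ y
permute-injective σ = Injection.injective (↔⇒↣ σ)

permute-≢ : (σ : CircOrd n) {x y : Fin n} → x ≢ y → σ ⟨$⟩ʳ x ≢ σ ⟨$⟩ʳ y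
permute-≢ σ x≢y = x≢y ∘ permute-injective σ

Successive : Fin n → Fin n → Set
Successive i j = toℕ j ≡ suc (toℕ i)

Neighbours : Fin n → Fin n → Set
Neighbours i j = Successive i j ⊎ Successive j i

Successive⇒< : {i j : Fin n} → Successive i j → i Fin.< j
Successive⇒< i⋖j = ℕₚ.≤-reflexive (sym i⋖j)

¬Between-successive : {p i j : Fin n} → Successive i j → ¬ Between p i j
¬Between-successive i⋖j (inj₁ (i<p , p<j)) = ℕₚ.<⇒≱ i<p (ℕ.s≤s⁻¹ (subst (toℕ _ ℕ.<_) i⋖j p<j))
¬Between-successive i⋖j (inj₂ (j<p , p<i)) = ℕₚ.<-asym (<-trans (Successive⇒< i⋖j) j<p) p<i

¬Between-neighbours : {p i j : Fin n} → Neighbours i j → ¬ Between p i j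
¬Between-neighbours (inj₁ i⋖j) = ¬Between-successive i⋖j
¬Between-neighbours (inj₂ j⋖i) = ¬Between-successive j⋖i ∘ Sum.swap

Between-successive : {i j c d : Fin n} → Successive i j → c ≢ j → d ≢ j → Between i c d → Between j c d
Between-successive i⋖j c≢j d≢j = Sum.map (step d≢j) (step c≢j)
  where
  step : ∀ {c d} → d ≢ _ → c Fin.< _ × _ Fin.< d → c Fin.< _ × _ Fin.< d
  step {d = d} d≢j (c<i , i<d) =
    <-trans c<i (Successive⇒< i⋖j) , ≤∧≢⇒< (subst (ℕ._≤ toℕ d) (sym i⋖j) i<d) (≢-sym d≢j)

Between-successive⁻ : {i j c d : Fin n} → Successive i j → c ≢ i → d ≢ i → Between j c d → Between i c d
Between-successive⁻ i⋖j c≢i d≢i = Sum.map (step c≢i) (step d≢i)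
  where
  step : ∀ {c d} → c ≢ _ → c Fin.< _ × _ Fin.< d → c Fin.< _ × _ Fin.< d
  step {c = c} c≢i (c<j , j<d) =
    ≤∧≢⇒< (ℕ.s≤s⁻¹ (subst (suc (toℕ c) ℕ.≤_) i⋖j c<j)) c≢i , <-trans (Successive⇒< i⋖j) j<d

Between-neighbours : {i j c d : Fin n} → Neighbours i j → c ≢ j → d ≢ j → Between i c d → Between j c d
Between-neighbours (inj₁ i⋖j) = Between-successive i⋖j
Between-neighbours (inj₂ j⋖i) = Between-successive⁻ j⋖i

Consecutive : CircOrd n → Edge n → Set
Consecutive σ (a , b) = Neighbours (σ ⟨$⟩ʳ a) (σ ⟨$⟩ʳ b)

separatesˡ-consecutive : (σ : CircOrd n) {e f : Edge n} → Consecutive σ e → Separates σ e f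
separatesˡ-consecutive _ a⋈b (inj₁ (c∈ab , _)) = ¬Between-neighbours a⋈b c∈ab
separatesˡ-consecutive _ a⋈b (inj₂ (_ , d∈ab)) = ¬Between-neighbours a⋈b d∈ab

separatesʳ-consecutive : (σ : CircOrd n) {e f : Edge n} → Consecutive σ f → NonAdjacent e f → Separates σ e f
separatesʳ-consecutive σ a⋈b (c≢a , c≢b , d≢a , d≢b) = λ
  { (inj₁ (a∈cd , b∉cd)) → b∉cd (Between-neighbours a⋈b (permute-≢ σ c≢b) (permute-≢ σ d≢b) a∈cd)
  ; (inj₂ (a∉cd , b∈cd)) → a∉cd (Between-neighbours (Sum.swap a⋈b) (permute-≢ σ c≢a) (permute-≢ σ d≢a) b∈cd) }

punchIn-mono-< : ∀ (i : Fin (suc n)) {j k} → j Fin.< k → punchIn i j Fin.< punchIn i k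
punchIn-mono-< i {j} {k} j<k = ≤∧≢⇒< (punchIn-mono-≤ i j k (ℕₚ.<⇒≤ j<k)) (<⇒≢ j<k ∘ punchIn-injective i j k)

punchIn-cancel-< : ∀ (i : Fin (suc n)) {j k} → punchIn i j Fin.< punchIn i k → j Fin.< k
punchIn-cancel-< i {j} {k} ij<ik = ≤∧≢⇒< (punchIn-cancel-≤ i j k (ℕₚ.<⇒≤ ij<ik)) λ { refl → <⇒≢ ij<ik refl }

punchIn-suc-successive : (i : Fin n) → Successive (punchIn (Fin.suc i) i) (Fin.suc i)
punchIn-suc-successive Fin.zero    = refl
punchIn-suc-successive (Fin.suc i) = cong suc (punchIn-suc-successive i)

insert-self : ∀ (i : Fin (suc m)) (j : Fin (suc n)) π → insert i j π ⟨$⟩ʳ i ≡ j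
insert-self i j π with i Fin.≟ i
... | yes _   = refl
... | no  i≢i = contradiction refl i≢i

permute-punchOut : (π : CircOrd (suc m)) {v x : Fin (suc m)} (v≢x : v ≢ x) →
                   π ⟨$⟩ʳ x ≡ punchIn (π ⟨$⟩ʳ v) (remove v π ⟨$⟩ʳ punchOut v≢x)
permute-punchOut π {v} {x} v≢x = begin
  π ⟨$⟩ʳ x                                               ≡⟨ cong (π ⟨$⟩ʳ_) (punchIn-punchOut v≢x) ⟨
  π ⟨$⟩ʳ punchIn v (punchOut v≢x)                          ≡⟨ punchIn-permute π v (punchOut v≢x) ⟩
  punchIn (π ⟨$⟩ʳ v) (remove v π ⟨$⟩ʳ punchOut v≢x)      ∎
  where open ≡-Reasoning

-- remove v σ is the ordering that σ induces on the vertices other than v.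
remove-≈⇒preserves-< : {σ τ : CircOrd (suc m)} {v x y : Fin (suc m)} → remove v σ ≈ remove v τ →
                       v ≢ x → v ≢ y → σ ⟨$⟩ʳ x Fin.< σ ⟨$⟩ʳ y → τ ⟨$⟩ʳ x Fin.< τ ⟨$⟩ʳ y
remove-≈⇒preserves-< {σ = σ} {τ} {v} σ∖v≈τ∖v v≢x v≢y σx<σy =
  subst₂ Fin._<_ (sym (permute-punchOut τ v≢x)) (sym (permute-punchOut τ v≢y))
    (punchIn-mono-< (τ ⟨$⟩ʳ v) (subst₂ Fin._<_ (σ∖v≈τ∖v _) (σ∖v≈τ∖v _) σ∖v-x<y))
  where
  σ∖v-x<y : remove v σ ⟨$⟩ʳ punchOut v≢x Fin.< remove v σ ⟨$⟩ʳ punchOut v≢y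
  σ∖v-x<y = punchIn-cancel-< (σ ⟨$⟩ʳ v)
    (subst₂ Fin._<_ (permute-punchOut σ v≢x) (permute-punchOut σ v≢y) σx<σy)

remove-≈⇒preserves-Between : {σ τ : CircOrd (suc m)} {v p a b : Fin (suc m)} → remove v σ ≈ remove v τ →
                             v ≢ p → v ≢ a → v ≢ b →
                             Between (σ ⟨$⟩ʳ p) (σ ⟨$⟩ʳ a) (σ ⟨$⟩ʳ b) → Between (τ ⟨$⟩ʳ p) (τ ⟨$⟩ʳ a) (τ ⟨$⟩ʳ b)
remove-≈⇒preserves-Between {σ = σ} {τ} {v} same v≢p v≢a v≢b =
  Sum.map (Product.map (preserve v≢a v≢p) (preserve v≢p v≢b))
          (Product.map (preserve v≢b v≢p) (preserve v≢p v≢a))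
  where
  preserve : ∀ {x y} → v ≢ x → v ≢ y → σ ⟨$⟩ʳ x Fin.< σ ⟨$⟩ʳ y → τ ⟨$⟩ʳ x Fin.< τ ⟨$⟩ʳ y
  preserve = remove-≈⇒preserves-< {σ = σ} {τ} same

remove-≈⇒preserves-Separates : {σ τ : CircOrd (suc m)} {v : Fin (suc m)} {e f : Edge (suc m)} →
                               remove v σ ≈ remove v τ → ¬ Incident v e → ¬ Incident v f →
                               Separates σ e f → Separates τ e f
remove-≈⇒preserves-Separates {σ = σ} {τ} {v} {a , b} {c , d} same v∉e v∉f σ-sep =
  σ-sep ∘ Sum.map (Product.map (back v≢c) (λ d∉ab → d∉ab ∘ forth v≢d))
                  (Product.map (λ c∉ab → c∉ab ∘ forth v≢c) (back v≢d))
  where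
  v≢a = λ v≡a → v∉e (inj₁ (sym v≡a))
  v≢b = λ v≡b → v∉e (inj₂ (sym v≡b))
  v≢c = λ v≡c → v∉f (inj₁ (sym v≡c))
  v≢d = λ v≡d → v∉f (inj₂ (sym v≡d))
  forth = λ {p} (v≢p : v ≢ p) → remove-≈⇒preserves-Between {σ = σ} {τ} same v≢p v≢a v≢b
  back  = λ {p} (v≢p : v ≢ p) → remove-≈⇒preserves-Between {σ = τ} {σ} (sym ∘ same) v≢p v≢a v≢b

moveAfter : (σ : CircOrd (suc m)) {v u : Fin (suc m)} → v ≢ u → CircOrd (suc m)
moveAfter σ {v} v≢u = insert v (Fin.suc (remove v σ ⟨$⟩ʳ punchOut v≢u)) (remove v σ)

remove-moveAfter : (σ : CircOrd (suc m)) {v u : Fin (suc m)} (v≢u : v ≢ u) →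
                   remove v (moveAfter σ v≢u) ≈ remove v σ
remove-moveAfter σ {v} v≢u = remove-insert v _ (remove v σ)

moveAfter-successive : (σ : CircOrd (suc m)) {v u : Fin (suc m)} (v≢u : v ≢ u) →
                       Successive (moveAfter σ v≢u ⟨$⟩ʳ u) (moveAfter σ v≢u ⟨$⟩ʳ v)
moveAfter-successive σ {v} {u} v≢u =
  subst₂ Successive (sym τu≡) (sym (insert-self v (Fin.suc q) (remove v σ))) (punchIn-suc-successive q)
  where
  q = remove v σ ⟨$⟩ʳ punchOut v≢u
  τu≡ : moveAfter σ v≢u ⟨$⟩ʳ u ≡ punchIn (Fin.suc q) q
  τu≡ = trans (cong (moveAfter σ v≢u ⟨$⟩ʳ_) (sym (punchIn-punchOut v≢u)))
              (insert-punchIn v (Fin.suc q) (remove v σ) (punchOut v≢u))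

Separates-swapˡ : {σ : CircOrd n} {a b c d : Fin n} → Separates σ (a , b) (c , d) → Separates σ (b , a) (c , d)
Separates-swapˡ sep = sep ∘ Sum.map (Product.map Sum.swap (_∘ Sum.swap)) (Product.map (_∘ Sum.swap) Sum.swap)

Separates-swapʳ : {σ : CircOrd n} {a b c d : Fin n} → Separates σ (a , b) (c , d) → Separates σ (a , b) (d , c)
Separates-swapʳ sep = sep ∘ Sum.swap ∘ Sum.map Product.swap Product.swap

Separates-Joins : {σ : CircOrd n} {e f : Edge n} {a b c d : Fin n} →
                  Joins e a b → Joins f c d → Separates σ (a , b) (c , d) → Separates σ e f
Separates-Joins (inj₁ refl) (inj₁ refl) = λ sep → sep
Separates-Joins {σ = σ} (inj₁ refl) (inj₂ refl) = Separates-swapʳ {σ = σ}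
Separates-Joins {σ = σ} (inj₂ refl) (inj₁ refl) = Separates-swapˡ {σ = σ}
Separates-Joins {σ = σ} (inj₂ refl) (inj₂ refl) = Separates-swapˡ {σ = σ} ∘ Separates-swapʳ {σ = σ}

NonAdjacent-Joins : {e f : Edge n} {a b c d : Fin n} →
                    Joins e a b → Joins f c d → NonAdjacent e f → NonAdjacent (a , b) (c , d)
NonAdjacent-Joins (inj₁ refl) (inj₁ refl) disjoint                  = disjoint
NonAdjacent-Joins (inj₁ refl) (inj₂ refl) (a≢d , a≢c , b≢d , b≢c) = a≢c , a≢d , b≢c , b≢d
NonAdjacent-Joins (inj₂ refl) (inj₁ refl) (b≢c , b≢d , a≢c , a≢d) = a≢c , a≢d , b≢c , b≢d
NonAdjacent-Joins (inj₂ refl) (inj₂ refl) (b≢d , b≢c , a≢d , a≢c) = a≢c , a≢d , b≢c , b≢d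

Joins-endpoints : {e₁ e₂ : Edge n} {x y : Fin n} → Joins e₁ x y → Joins e₂ x y → Joins e₂ (proj₁ e₁) (proj₂ e₁)
Joins-endpoints (inj₁ refl) e₂xy = e₂xy
Joins-endpoints (inj₂ refl) e₂xy = Sum.swap e₂xy

Joins⇒Consecutive : (σ : CircOrd n) {e : Edge n} {x y : Fin n} →
                    Joins e x y → Successive (σ ⟨$⟩ʳ x) (σ ⟨$⟩ʳ y) → Consecutive σ e
Joins⇒Consecutive _ (inj₁ refl) = inj₁
Joins⇒Consecutive _ (inj₂ refl) = inj₂

TwoSeparated : List (Edge n) → Set
TwoSeparated {n} E = ∃₂ λ (σ₁ σ₂ : CircOrd n) → ∀ {e f} → e ∈ₗ E → f ∈ₗ E → NonAdjacent e f →
                     Separates σ₁ e f ⊎ Separates σ₂ e f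

TwoSeparated-single : (e : Edge n) → TwoSeparated (e ∷ [])
TwoSeparated-single _ = id , id , λ { (here refl) (here refl) (a≢a , _) → contradiction refl a≢a }

TwoSeparated-cover : {E E′ : List (Edge n)} →
                     (∀ {e} → e ∈ₗ E → ∃ λ e′ → e′ ∈ₗ E′ × Joins e (proj₁ e′) (proj₂ e′)) →
                     TwoSeparated E′ → TwoSeparated E
TwoSeparated-cover {E = E} cover (σ₁ , σ₂ , sep) = σ₁ , σ₂ , separate
  where
  separate : ∀ {e f} → e ∈ₗ E → f ∈ₗ E → NonAdjacent e f → Separates σ₁ e f ⊎ Separates σ₂ e f
  separate e∈E f∈E e∦f with cover e∈E | cover f∈E
  ... | _ , e′∈E′ , e∼e′ | _ , f′∈E′ , f∼f′ =
    Sum.map (Separates-Joins {σ = σ₁} e∼e′ f∼f′) (Separates-Joins {σ = σ₂} e∼e′ f∼f′)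
            (sep e′∈E′ f′∈E′ (NonAdjacent-Joins e∼e′ f∼f′ e∦f))

TwoSeparated-parallel : {E E′ : List (Edge n)} {e₁ e₂ : Edge n} {x y : Fin n} →
                        E ↭ e₁ ∷ e₂ ∷ E′ → Joins e₁ x y → Joins e₂ x y →
                        TwoSeparated (e₁ ∷ E′) → TwoSeparated E
TwoSeparated-parallel {e₁ = e₁} E↭ e₁xy e₂xy = TwoSeparated-cover (represent ∘ ∈-resp-↭ E↭)
  where
  represent : ∀ {e} → e ∈ₗ e₁ ∷ _ ∷ _ → ∃ λ e′ → e′ ∈ₗ e₁ ∷ _ × Joins e (proj₁ e′) (proj₂ e′)
  represent (here refl)         = e₁ , here refl , inj₁ refl
  represent (there (here refl)) = e₁ , here refl , Joins-endpoints e₁xy e₂xy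
  represent (there (there e∈)) = _ , there e∈ , inj₁ refl

TwoSeparated-series : {E E′ : List (Edge (suc m))} {e₁ e₂ : Edge (suc m)} {u v w : Fin (suc m)} →
                      u ≢ v → w ≢ v → E ↭ e₁ ∷ e₂ ∷ E′ → Joins e₁ u v → Joins e₂ v w →
                      All (λ e → ¬ Incident v e) E′ → TwoSeparated ((u , w) ∷ E′) → TwoSeparated E
TwoSeparated-series {E′ = E′} u≢v w≢v E↭ e₁uv e₂vw v∉E′ (σ₁ , σ₂ , sep) =
  τ₁ , τ₂ , λ e∈E f∈E → separate (classify (∈-resp-↭ E↭ e∈E)) (classify (∈-resp-↭ E↭ f∈E))
  where
  v≢u = ≢-sym u≢v
  v≢w = ≢-sym w≢v
  τ₁ = moveAfter σ₁ v≢u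
  τ₂ = moveAfter σ₂ v≢w

  Kind : Edge _ → Set
  Kind e = Consecutive τ₁ e ⊎ Consecutive τ₂ e ⊎ e ∈ₗ E′

  classify : ∀ {e} → e ∈ₗ _ ∷ _ ∷ E′ → Kind e
  classify (here refl)          = inj₁ (Joins⇒Consecutive τ₁ e₁uv (moveAfter-successive σ₁ v≢u))
  classify (there (here refl))  = inj₂ (inj₁ (Joins⇒Consecutive τ₂ (Sum.swap e₂vw) (moveAfter-successive σ₂ v≢w)))
  classify (there (there e∈E′)) = inj₂ (inj₂ e∈E′)

  separate : ∀ {e f} → Kind e → Kind f → NonAdjacent e f → Separates τ₁ e f ⊎ Separates τ₂ e f
  separate (inj₁ e⋈τ₁)          _                    _   = inj₁ (separatesˡ-consecutive τ₁ e⋈τ₁)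
  separate (inj₂ (inj₁ e⋈τ₂))   _                    _   = inj₂ (separatesˡ-consecutive τ₂ e⋈τ₂)
  separate (inj₂ (inj₂ _))      (inj₁ f⋈τ₁)          e∦f = inj₁ (separatesʳ-consecutive τ₁ f⋈τ₁ e∦f)
  separate (inj₂ (inj₂ _))      (inj₂ (inj₁ f⋈τ₂))   e∦f = inj₂ (separatesʳ-consecutive τ₂ f⋈τ₂ e∦f)
  separate (inj₂ (inj₂ e∈E′))   (inj₂ (inj₂ f∈E′))   e∦f =
    Sum.map (remove-≈⇒preserves-Separates {σ = σ₁} {τ₁} (sym ∘ remove-moveAfter σ₁ v≢u) v∉e v∉f)
            (remove-≈⇒preserves-Separates {σ = σ₂} {τ₂} (sym ∘ remove-moveAfter σ₂ v≢w) v∉e v∉f)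
            (sep (there e∈E′) (there f∈E′) e∦f)
    where
    v∉e = lookup v∉E′ e∈E′
    v∉f = lookup v∉E′ f∈E′

TwoSeparated-unstep : {s t : Fin n} {A B : MState n} → SPStep s t A B →
                      TwoSeparated (proj₂ B) → TwoSeparated (proj₂ A)
TwoSeparated-unstep (parallel E↭ e₁xy e₂xy) = TwoSeparated-parallel E↭ e₁xy e₂xy
TwoSeparated-unstep {n = suc _} (series _ _ _ u≢v w≢v E↭ e₁uv e₂vw v∉E′) =
  TwoSeparated-series u≢v w≢v E↭ e₁uv e₂vw v∉E′

TwoSeparated-unreduce : {s t : Fin n} {A B : MState n} → Star (SPStep s t) A B →
                        TwoSeparated (proj₂ B) → TwoSeparated (proj₂ A)
TwoSeparated-unreduce ε              = λ sep → sep
TwoSeparated-unreduce (step ◅ steps) = TwoSeparated-unstep step ∘ TwoSeparated-unreduce steps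

theorem2 : (G : Graph) → SeriesParallel G → CircSepDim≤ G 2
theorem2 _ (_ , _ , (_ , _ ∷ []) , reduction , (_ , _ , _ , refl , _)) =
  let σ₁ , σ₂ , sep = TwoSeparated-unreduce reduction (TwoSeparated-single _)
  in σ₁ ∷ σ₂ ∷ [] , s≤s (s≤s z≤n) , λ e∈G f∈G e∦f → Sum.[ here , there ∘ here ]′ (sep e∈G f∈G e∦f)
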